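{- Let $H$ be a finite connected graph with a unique cut-vertex $v$, and let $G_1,\ldots,G_s$ be the connected components of $H-v$. Let $k\ge 1$. If there exists $i\in\{1,\ldots,s\}$ such that $\text{BROADCAST}(G_i\cup\{v\},k)$ is an Adversary win, where $G_i\cup\{v\}$ denotes the subgraph of $H$ induced by $V(G_i)\cup\{v\}$, then $\text{BROADCAST}(H,k)$ is also an Adversary win.
   Context: For a finite connected graph $G$ and an integer $k\ge 1$, $\text{BROADCAST}(G,k)$ is a game between a team of $k$ agents ("Agents") and "Adversary". Setup: Adversary places $k-1$ ignorant agents and $1$ knowledgeable agent on $k$ distinct vertices of $G$. At each time $t=1,2,\ldots$: first Adversary selects an arbitrary connected spanning subgraph $G_t$ of $G$; then each agent either stays at its vertex or moves to a vertex adjacent to it in $G_t$. If after this move several agents are located at the same vertex and at least one of them was knowledgeable at time $t-1$, all of them become knowledgeable at time $t$. Agents win if all agents become knowledgeable. The game is an Agents win if Agents have a strategy guaranteeing this (against every Adversary strategy), and an Adversary win if Adversary has a strategy preventing all agents from ever becoming knowledgeable. -}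

module Defs where

open import Data.Nat using (ℕ; zero; suc)
open import Data.Fin using (Fin; _≟_)
open import Data.Fin.Properties using ()
open import Data.Bool using (Bool; true; false; _∧_; _∨_; not)
open import Data.List using (List; []; _∷_; allFin)
open import Data.Bool.ListAction using (any)
open import Data.Product using (Σ; ∃; ∃-syntax; _×_; _,_; proj₁; proj₂)
open import Data.Sum using (_⊎_)
open import Relation.Nullary using (¬_)
open import Relation.Nullary.Decidable using (⌊_⌋)
open import Relation.Binary.PropositionalEquality using (_≡_; _≢_)
open import Function.Definitions using (Injective)

_==_ : ∀ {n} → Fin n → Fin n → Bool
x == y = ⌊ x ≟ y ⌋

record Graph (n : ℕ) : Set where
  field
    adj   : Fin n → Fin n → Bool
    sym   : ∀ u w → adj u w ≡ adj w u
    irrefl : ∀ u → adj u u ≡ false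
open Graph public

data Reach {n : ℕ} (E : Fin n → Fin n → Bool) : Fin n → Fin n → Set where
  here : ∀ {u} → Reach E u u
  step : ∀ {u w x} → E u w ≡ true → Reach E w x → Reach E u x

Connected : ∀ {n} → (Fin n → Fin n → Bool) → Set
Connected E = ∀ u w → Reach E u w

-- edges of G not touching v (the graph G - v)
avoid : ∀ {n} → Graph n → Fin n → Fin n → Fin n → Bool
avoid G v x y = adj G x y ∧ not (x == v) ∧ not (y == v)

CutVertex : ∀ {n} → Graph n → Fin n → Set
CutVertex G v = ∃[ u ] ∃[ w ] (u ≢ v × w ≢ v × ¬ Reach (avoid G v) u w)

UniqueCutVertex : ∀ {n} → Graph n → Fin n → Set
UniqueCutVertex G v = CutVertex G v × (∀ w → CutVertex G w → w ≡ v)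

induce : ∀ {m n} → Graph n → (Fin m → Fin n) → Graph m
induce G f = record
  { adj = λ x y → adj G (f x) (f y)
  ; sym = λ x y → sym G (f x) (f y)
  ; irrefl = λ x → irrefl G (f x) }

-- x lies in V(C) ∪ {v}, where C is the component of G - v containing u
InCompPlusV : ∀ {n} → Graph n → Fin n → Fin n → Fin n → Set
InCompPlusV G v u x = x ≡ v ⊎ (x ≢ v × Reach (avoid G v) u x)

-- connected spanning subgraphs of G (chosen by Adversary each round)
record SpanSub {n : ℕ} (G : Graph n) : Set where
  field
    E      : Fin n → Fin n → Bool
    E⊆     : ∀ u w → E u w ≡ true → adj G u w ≡ true
    Esym   : ∀ u w → E u w ≡ E w u
    Econn  : Connected E
open SpanSub public

record Config (k n : ℕ) : Set where
  constructor cfg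
  field
    pos  : Fin k → Fin n
    know : Fin k → Bool
open Config public

LegalMove : ∀ {n k} {G : Graph n} → SpanSub G → Config k n → Set
LegalMove {n} {k} S c =
  Σ (Fin k → Fin n) λ p' → ∀ a → p' a ≡ pos c a ⊎ E S (pos c a) (p' a) ≡ true

newKnow : ∀ {k n} → Config k n → (Fin k → Fin n) → Fin k → Bool
newKnow {k} c p' a = know c a ∨ any (λ b → (p' b == p' a) ∧ know c b) (allFin k)

-- history: initial configuration and the rounds played so far
-- (subgraph G_t and configuration at time t), most recent first
History : ∀ {n} → Graph n → ℕ → Set
History {n} G k = Config k n × List (SpanSub G × Config k n)

current : ∀ {n k} {G : Graph n} → History G k → Config k n
current (c₀ , [])          = c₀
current (_  , (_ , c) ∷ _) = c

record AdvStrategy {n : ℕ} (G : Graph n) (k : ℕ) : Set where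
  field
    initPos   : Fin k → Fin n
    initInj   : Injective _≡_ _≡_ initPos
    informed  : Fin k
    choose    : History G k → SpanSub G
open AdvStrategy public

AgStrategy : ∀ {n} → Graph n → ℕ → Set
AgStrategy G k = (h : History G k) → (S : SpanSub G) → LegalMove S (current h)

initConfig : ∀ {n k} {G : Graph n} → AdvStrategy G k → Config k n
initConfig A = cfg (initPos A) (λ a → a == informed A)

play : ∀ {n k} {G : Graph n} → AdvStrategy G k → AgStrategy G k → ℕ → History G k
play A B zero = initConfig A , []
play A B (suc t) with play A B t
... | h with choose A h
... | S with B h S
... | p' , _ = proj₁ h , (S , cfg p' (newKnow (current h) p')) ∷ proj₂ h

AllKnow : ∀ {k n} → Config k n → Set
AllKnow c = ∀ a → know c a ≡ true

AdversaryWin : ∀ {n} → Graph n → ℕ → Set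
AdversaryWin G k =
  Σ (AdvStrategy G k) λ A → (B : AgStrategy G k) → (t : ℕ) →
    ¬ AllKnow (current (play A B t))

{-# OPTIONS --safe #-}
module Submission where

-- The rest of H meets the block B = G_i ∪ {v} only at v, so the retraction of H onto B that
-- sends every vertex outside B to v turns each edge of H into an edge of B or a single vertex.
-- Adversary plays its winning strategy for B on the edges inside B and keeps every other edge
-- of H; projecting the agents of H by the retraction gives a play in B against that strategy.
-- Agents that meet in H meet in the projection, so the projected agents always know at least
-- as much, and they never all become knowledgeable.

open import Defs hiding (sym)
open import Data.Nat using (ℕ; _≤_; zero; suc)
open import Data.Fin using (Fin; _≟_)
open import Data.Fin.Properties using (any?)
open import Data.Bool using (Bool; true; T; _∧_)
open import Data.Bool.ListAction using (any)
open import Data.Bool.Properties using (T-≡; T-∧; T-∨) renaming (_≟_ to _≟ᵇ_)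
open import Data.List using (List; []; _∷_; length; allFin)
open import Data.List.Relation.Unary.Any using () renaming (map to any-map)
open import Data.List.Relation.Unary.Any.Properties using (any⁺; any⁻)
open import Data.Product using (Σ; ∃; _×_; _,_; proj₁; proj₂)
import Data.Product as Product
open import Data.Sum using (_⊎_; inj₁; inj₂)
import Data.Sum as Sum
open import Function using (_∘_; id)
open import Function.Bundles using (Equivalence)
open import Function.Definitions using (Injective)
open import Relation.Nullary using (¬_; Dec; yes; no; contradiction)
open import Relation.Nullary.Decidable using (_⊎-dec_; dec-no; toWitness; fromWitness)
open import Relation.Binary.PropositionalEquality
  using (_≡_; _≢_; refl; sym; trans; cong; cong₂; subst)

open Equivalence using (to; from)

Reach-snoc : ∀ {n} {E : Fin n → Fin n → Bool} {x y z} → Reach E x y → E y z ≡ true → Reach E x z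
Reach-snoc here       e = step e here
Reach-snoc (step d r) e = step d (Reach-snoc r e)

Reach-++ : ∀ {n} {E : Fin n → Fin n → Bool} {x y z} → Reach E x y → Reach E y z → Reach E x z
Reach-++ here       r′ = r′
Reach-++ (step e r) r′ = step e (Reach-++ r r′)

Reach-reverse : ∀ {n} {E : Fin n → Fin n → Bool} → (∀ x y → E x y ≡ E y x) →
  ∀ {x y} → Reach E x y → Reach E y x
Reach-reverse E-sym here                       = here
Reach-reverse E-sym (step {u = x} {w = y} e r) = Reach-snoc (Reach-reverse E-sym r) (trans (E-sym y x) e)

Reach-map : ∀ {m n} {E : Fin m → Fin m → Bool} {E′ : Fin n → Fin n → Bool} (g : Fin m → Fin n) →
  (∀ {x y} → E x y ≡ true → E′ (g x) (g y) ≡ true) → ∀ {x y} → Reach E x y → Reach E′ (g x) (g y)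
Reach-map g g-edge here       = here
Reach-map g g-edge (step e r) = step (g-edge e) (Reach-map g g-edge r)

InImage : ∀ {m n} → (Fin m → Fin n) → Fin n → Set
InImage f x = ∃ λ y → f y ≡ x

Move : ∀ {n} {G : Graph n} → SpanSub G → Fin n → Fin n → Set
Move S x y = y ≡ x ⊎ E S x y ≡ true

move? : ∀ {n} {G : Graph n} (S : SpanSub G) x y → Dec (Move S x y)
move? S x y = (y ≟ x) ⊎-dec (E S x y ≟ᵇ true)

moveOrStay : ∀ {n} {G : Graph n} → SpanSub G → Fin n → Fin n → Fin n
moveOrStay S x y with move? S x y
... | yes _ = y
... | no  _ = x

moveOrStay-move : ∀ {n} {G : Graph n} (S : SpanSub G) x y → Move S x (moveOrStay S x y)
moveOrStay-move S x y with move? S x y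
... | yes xy = xy
... | no  _  = inj₁ refl

moveOrStay-≡ : ∀ {n} {G : Graph n} (S : SpanSub G) {x y} → Move S x y → moveOrStay S x y ≡ y
moveOrStay-≡ S {x} {y} xy with move? S x y
... | yes _   = refl
... | no ¬xy = contradiction xy ¬xy

moveTo : ∀ {k n} → Config k n → (Fin k → Fin n) → Config k n
moveTo c p = cfg p (newKnow c p)

extend : ∀ {n k} {G : Graph n} → History G k → SpanSub G → (Fin k → Fin n) → History G k
extend h S p = proj₁ h , (S , moveTo (current h) p) ∷ proj₂ h

length-play : ∀ {n k} {G : Graph n} (A : AdvStrategy G k) (B : AgStrategy G k) t →
  length (proj₂ (play A B t)) ≡ t
length-play A B zero    = refl
length-play A B (suc t) = cong suc (length-play A B t)

newKnow-retract : ∀ {k m n} (r : Fin n → Fin m) {c : Config k n} {c′ : Config k m} {p q} →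
  (∀ a → q a ≡ r (p a)) → (∀ a → know c a ≡ true → know c′ a ≡ true) →
  ∀ a → newKnow c p a ≡ true → newKnow c′ q a ≡ true
newKnow-retract {k} r {c} {c′} {p} {q} q≡rp knows a =
  to T-≡ ∘ from T-∨ ∘ Sum.map (from T-≡ ∘ knows a ∘ to T-≡) spread ∘ to T-∨ ∘ from T-≡
  where
  sameVertex : ∀ {b} → p b ≡ p a → q b ≡ q a
  sameVertex {b} e = trans (q≡rp b) (trans (cong r e) (sym (q≡rp a)))

  meets : ∀ {b} → T ((p b == p a) ∧ know c b) → T ((q b == q a) ∧ know c′ b)
  meets {b} = from T-∧ ∘ Product.map (fromWitness ∘ sameVertex ∘ toWitness {a? = p b ≟ p a})
                                      (from T-≡ ∘ knows b ∘ to T-≡) ∘ to T-∧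

  spread : T (any (λ b → (p b == p a) ∧ know c b) (allFin k)) →
           T (any (λ b → (q b == q a) ∧ know c′ b) (allFin k))
  spread = any⁺ _ ∘ any-map meets ∘ any⁻ _ (allFin k)

record Retract {n m : ℕ} (H : Graph n) (G : Graph m) : Set where
  field
    embed         : Fin m → Fin n
    retract       : Fin n → Fin m
    retract-embed : ∀ y → retract (embed y) ≡ y
    liftSpan      : SpanSub G → SpanSub H
    retract-move  : ∀ S {x y} → Move (liftSpan S) x y → Move S (retract x) (retract y)

  embed-injective : Injective _≡_ _≡_ embed
  embed-injective {y} {y′} e = trans (sym (retract-embed y)) (trans (cong retract e) (retract-embed y′))

module _ {n m} {H : Graph n} {G : Graph m} (R : Retract H G) where
  open Retract R

  module Shadow {k} (A′ : AdvStrategy G k) where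

    -- Off the actual play the projected move need not be legal; the agent then stays.
    shadowMove : (c : Config k m) (S : SpanSub G) → (Fin k → Fin n) → LegalMove S c
    shadowMove c S p = (λ a → moveOrStay S (pos c a) (retract (p a))) ,
                       (λ a → moveOrStay-move S (pos c a) (retract (p a)))

    shadowStep : History G k → (Fin k → Fin n) → History G k
    shadowStep h p = extend h S (proj₁ (shadowMove (current h) S p))
      where
      S : SpanSub G
      S = choose A′ h

    shadowRounds : List (SpanSub H × Config k n) → History G k
    shadowRounds []             = initConfig A′ , []
    shadowRounds ((_ , c) ∷ rs) = shadowStep (shadowRounds rs) (pos c)

    shadow : History H k → History G k
    shadow h = shadowRounds (proj₂ h)

    liftedAdversary : AdvStrategy H k
    liftedAdversary = record
      { initPos  = embed ∘ initPos A′
      ; initInj  = initInj A′ ∘ embed-injective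
      ; informed = informed A′
      ; choose   = liftSpan ∘ choose A′ ∘ shadow
      }

    Shadows : Config k n → Config k m → Set
    Shadows c c′ = (∀ a → pos c′ a ≡ retract (pos c a)) × (∀ a → know c a ≡ true → know c′ a ≡ true)

    Shadows-move : ∀ {c c′} S (p : LegalMove (liftSpan S) c) → Shadows c c′ →
      Shadows (moveTo c (proj₁ p)) (moveTo c′ (proj₁ (shadowMove c′ S (proj₁ p))))
    Shadows-move {c} {c′} S (p , legal) (positions , knows) =
      positions′ , newKnow-retract retract {c = c} {c′ = c′} {p = p} positions′ knows
      where
      positions′ : ∀ a → proj₁ (shadowMove c′ S p) a ≡ retract (p a)
      positions′ a = moveOrStay-≡ S
        (subst (λ x → Move S x (retract (p a))) (sym (positions a)) (retract-move S (legal a)))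

    module _ (B : AgStrategy H k) where

      play-H : ℕ → History H k
      play-H = play liftedAdversary B

      respond : History G k → ℕ → History G k
      respond h t = shadowStep h (proj₁ (B (play-H t) (liftSpan (choose A′ h))))

      -- A history of length t is answered by projecting B's move at time t of the lifted play.
      shadowAgents : AgStrategy G k
      shadowAgents h S = shadowMove (current h) S (proj₁ (B (play-H (length (proj₂ h))) (liftSpan S)))

      play-shadow : ∀ t → play A′ shadowAgents t ≡ shadow (play-H t)
      play-shadow zero    = refl
      play-shadow (suc t) = cong₂ respond (play-shadow t) (length-play A′ shadowAgents t)

      shadows-play : ∀ t → Shadows (current (play-H t)) (current (shadow (play-H t)))
      shadows-play zero    = (λ a → sym (retract-embed (initPos A′ a))) , λ a → id
      shadows-play (suc t) = Shadows-move S (B (play-H t) (liftSpan S)) (shadows-play t)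
        where
        S : SpanSub G
        S = choose A′ (shadow (play-H t))

      liftedAdversary-wins : (∀ B′ t → ¬ AllKnow (current (play A′ B′ t))) →
        ∀ t → ¬ AllKnow (current (play-H t))
      liftedAdversary-wins W t allKnow =
        W shadowAgents t (subst (AllKnow ∘ current) (sym (play-shadow t))
                                (λ a → proj₂ (shadows-play t) a (allKnow a)))

  adversaryWin-retract : ∀ {k} → AdversaryWin G k → AdversaryWin H k
  adversaryWin-retract (A′ , W) = liftedAdversary , λ B → liftedAdversary-wins B W
    where open Shadow A′

module _ {n m} (H : Graph n) (connected : Connected (adj H))
         {f : Fin m → Fin n} (f-injective : Injective _≡_ _≡_ f) (c : Fin m)
         (attached : ∀ {x y} → ¬ InImage f x → adj H (f y) x ≡ true → y ≡ c) where

  image? : ∀ x → Dec (InImage f x)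
  image? x = any? (λ y → f y ≟ x)

  collapse : Fin n → Fin m
  collapse x with image? x
  ... | yes (y , _) = y
  ... | no  _       = c

  collapse-embed : ∀ y → collapse (f y) ≡ y
  collapse-embed y with image? (f y)
  ... | yes (_ , e) = f-injective e
  ... | no  ¬fy    = contradiction (y , refl) ¬fy

  liftedAdj : SpanSub (induce H f) → Fin n → Fin n → Bool
  liftedAdj S x z with image? x | image? z
  ... | yes (y₁ , _) | yes (y₂ , _) = E S y₁ y₂
  ... | _            | _            = adj H x z

  liftedAdj-embed : ∀ S {y₁ y₂} → E S y₁ y₂ ≡ true → liftedAdj S (f y₁) (f y₂) ≡ true
  liftedAdj-embed S {y₁} {y₂} e with image? (f y₁) | image? (f y₂)
  ... | yes (_ , e₁)   | yes (_ , e₂)   rewrite f-injective e₁ | f-injective e₂ = e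
  ... | yes _          | no ¬fy₂        = contradiction (y₂ , refl) ¬fy₂
  ... | no ¬fy₁        | _              = contradiction (y₁ , refl) ¬fy₁

  liftedAdj-outside : ∀ S {x z} → ¬ InImage f x → liftedAdj S x z ≡ adj H x z
  liftedAdj-outside S {x} {z} ¬fx with image? x
  ... | yes fx = contradiction fx ¬fx
  ... | no  _  = refl

  liftedAdj⊆adj : ∀ S x z → liftedAdj S x z ≡ true → adj H x z ≡ true
  liftedAdj⊆adj S x z with image? x | image? z
  ... | yes (y₁ , refl) | yes (y₂ , refl) = E⊆ S y₁ y₂
  ... | yes _           | no  _           = id
  ... | no  _           | _               = id

  liftedAdj-sym : ∀ S x z → liftedAdj S x z ≡ liftedAdj S z x
  liftedAdj-sym S x z with image? x | image? z
  ... | yes (y₁ , _) | yes (y₂ , _) = Esym S y₁ y₂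
  ... | yes _        | no  _        = Graph.sym H x z
  ... | no  _        | yes _        = Graph.sym H x z
  ... | no  _        | no  _        = Graph.sym H x z

  -- Walk along H until the image of f is reached, then inside it along S.
  reach-attachment : ∀ S {x} → Reach (adj H) x (f c) → Reach (liftedAdj S) x (f c)
  reach-attachment S {x} r with image? x
  ... | yes (y , refl) = Reach-map f (liftedAdj-embed S) (Econn S y c)
  reach-attachment S here       | no ¬fx = contradiction (c , refl) ¬fx
  reach-attachment S (step e r) | no ¬fx =
    step (trans (liftedAdj-outside S ¬fx) e) (reach-attachment S r)

  liftSpan : SpanSub (induce H f) → SpanSub H
  liftSpan S = record
    { E     = liftedAdj S
    ; E⊆    = liftedAdj⊆adj S
    ; Esym  = liftedAdj-sym S
    ; Econn = λ x z → Reach-++ (reach-attachment S (connected x (f c)))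
                        (Reach-reverse (liftedAdj-sym S) (reach-attachment S (connected z (f c))))
    }

  collapse-move : ∀ S {x z} → Move (liftSpan S) x z → Move S (collapse x) (collapse z)
  collapse-move S (inj₁ z≡x) = inj₁ (cong collapse z≡x)
  collapse-move S {x} {z} (inj₂ e) with image? x | image? z
  ... | yes (y₁ , refl) | yes (y₂ , refl) = inj₂ e
  ... | yes (y₁ , refl) | no ¬fz          = inj₁ (sym (attached ¬fz e))
  ... | no ¬fx          | yes (y₂ , refl) = inj₁ (attached ¬fx (trans (Graph.sym H (f y₂) x) e))
  ... | no _            | no _            = inj₁ refl

  attachedRetract : Retract H (induce H f)
  attachedRetract = record
    { embed         = f
    ; retract       = collapse
    ; retract-embed = collapse-embed
    ; liftSpan      = liftSpan
    ; retract-move  = collapse-move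
    }

InCompPlusV-adj : ∀ {n} (H : Graph n) {v u w x} → w ≢ v → Reach (avoid H v) u w →
  adj H w x ≡ true → InCompPlusV H v u x
InCompPlusV-adj H {v} {u} {w} {x} w≢v r e with x ≟ v
... | yes x≡v = inj₁ x≡v
... | no  x≢v = inj₂ (x≢v , Reach-snoc r avoid-edge)
  where
  avoid-edge : avoid H v w x ≡ true
  avoid-edge rewrite e | dec-no (w ≟ v) w≢v | dec-no (x ≟ v) x≢v = refl

mainTheorem1 : (n : ℕ) (H : Graph n) → Connected (adj H) →
    (v : Fin n) → UniqueCutVertex H v →
    (k : ℕ) → 1 ≤ k →
    (u : Fin n) → u ≢ v →
    (m : ℕ) (f : Fin m → Fin n) → Injective _≡_ _≡_ f →
    (∀ x → InCompPlusV H v u x → Σ (Fin m) (λ y → f y ≡ x)) →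
    (∀ y → InCompPlusV H v u (f y)) →
    AdversaryWin (induce H f) k →
    AdversaryWin H k
mainTheorem1 n H connected v _ k _ u _ m f f-injective onto into =
  adversaryWin-retract (attachedRetract H connected f-injective c attached)
  where
  c : Fin m
  c = proj₁ (onto v (inj₁ refl))

  attached : ∀ {x y} → ¬ InImage f x → adj H (f y) x ≡ true → y ≡ c
  attached {x} {y} ¬fx e with into y
  ... | inj₁ fy≡v       = f-injective (trans fy≡v (sym (proj₂ (onto v (inj₁ refl)))))
  ... | inj₂ (fy≢v , r) = contradiction (onto x (InCompPlusV-adj H fy≢v r e)) ¬fx
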